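{- For every $n$, $\mathrm{ex}(n,K_3,T_1)=\mathrm{ex}(n,K_3,P_4)=\mathcal{N}(K_3,D(3,n))=\lfloor n/3\rfloor$.
   Context: $T_1$ (the paw) is a triangle together with one extra vertex joined to exactly one vertex of the triangle; $P_4$ is the path on $4$ vertices. $D(3,n)$ is the $n$-vertex graph consisting of $\lfloor n/3\rfloor$ vertex-disjoint triangles together with a clique on the remaining vertices. $\mathcal{N}(H,G)$ is the number of subgraphs of $G$ isomorphic to $H$; $\mathrm{ex}(n,H,F)$ is the maximum of $\mathcal{N}(H,G)$ over $F$-free $n$-vertex graphs $G$. -}

module Defs where

open import Data.Nat using (ℕ; zero; suc; _+_; _*_; _≤_; _/_; _≡ᵇ_; _<ᵇ_)
open import Data.Bool using (Bool; true; false; _∧_; _∨_; not; if_then_else_)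
open import Data.Bool.Properties using (∨-comm)
open import Data.Fin using (Fin; toℕ; zero; suc)
open import Data.List using (List; map; allFin)
open import Data.Nat.ListAction using (sum)
open import Data.Product using (Σ; ∃; _×_; _,_)
open import Function.Definitions using (Injective)
open import Relation.Binary.PropositionalEquality using (_≡_; refl)
open import Relation.Nullary using (¬_)

record Graph (n : ℕ) : Set where
  field
    adj    : Fin n → Fin n → Bool
    sym    : ∀ i j → adj i j ≡ adj j i
    irrefl : ∀ i → adj i i ≡ false
open Graph public

_⊆G_ : ∀ {m n} → Graph m → Graph n → Set
_⊆G_ {m} {n} H G =
  Σ (Fin m → Fin n) λ f →
    Injective _≡_ _≡_ f × (∀ i j → adj H i j ≡ true → adj G (f i) (f j) ≡ true)

Free : ∀ {m n} → Graph m → Graph n → Set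
Free F G = ¬ (F ⊆G G)

isTri : ∀ {n} → Graph n → Fin n → Fin n → Fin n → Bool
isTri G i j k = (toℕ i <ᵇ toℕ j) ∧ (toℕ j <ᵇ toℕ k)
                ∧ adj G i j ∧ adj G j k ∧ adj G i k

triangles : ∀ {n} → Graph n → ℕ
triangles {n} G =
  sum (map (λ i → sum (map (λ j → sum (map (λ k →
    if isTri G i j k then 1 else 0) (allFin n))) (allFin n))) (allFin n))

ExK3 : ∀ {k} → ℕ → Graph k → ℕ → Set
ExK3 n F m =
  (Σ (Graph n) λ G → Free F G × triangles G ≡ m)
  × (∀ (G : Graph n) → Free F G → triangles G ≤ m)

private
  symClose : (Fin 4 → Fin 4 → Bool) → Fin 4 → Fin 4 → Bool
  symClose e i j = e i j ∨ e j i

pawE : Fin 4 → Fin 4 → Bool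
pawE zero (suc zero) = true
pawE zero (suc (suc zero)) = true
pawE (suc zero) (suc (suc zero)) = true
pawE zero (suc (suc (suc zero))) = true
pawE _ _ = false

p4E : Fin 4 → Fin 4 → Bool
p4E zero (suc zero) = true
p4E (suc zero) (suc (suc zero)) = true
p4E (suc (suc zero)) (suc (suc (suc zero))) = true
p4E _ _ = false

T1 : Graph 4
T1 = record
  { adj = λ i j → pawE i j ∨ pawE j i
  ; sym = λ i j → ∨-comm (pawE i j) (pawE j i)
  ; irrefl = λ { zero → refl ; (suc zero) → refl ; (suc (suc zero)) → refl
               ; (suc (suc (suc zero))) → refl } }

P4 : Graph 4
P4 = record
  { adj = λ i j → p4E i j ∨ p4E j i
  ; sym = λ i j → ∨-comm (p4E i j) (p4E j i)
  ; irrefl = λ { zero → refl ; (suc zero) → refl ; (suc (suc zero)) → refl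
               ; (suc (suc (suc zero))) → refl } }

-- D(3,n): vertices v < 3⌊n/3⌋ are split into the triangles {3q,3q+1,3q+2};
-- the remaining vertices (those with v / 3 = ⌊n/3⌋) form a clique.
D3 : (n : ℕ) → Graph n
D3 n = record
  { adj = λ u v → (toℕ u / 3 ≡ᵇ toℕ v / 3) ∧ not (toℕ u ≡ᵇ toℕ v)
  ; sym = symP
  ; irrefl = irr }
  where
  open import Data.Bool.Properties using (∧-zeroʳ)
  open import Relation.Binary.PropositionalEquality using (cong; cong₂; trans)
  ≡ᵇ-refl : ∀ a → (a ≡ᵇ a) ≡ true
  ≡ᵇ-refl zero = refl
  ≡ᵇ-refl (suc a) = ≡ᵇ-refl a
  ≡ᵇ-sym : ∀ a b → (a ≡ᵇ b) ≡ (b ≡ᵇ a)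
  ≡ᵇ-sym zero zero = refl
  ≡ᵇ-sym zero (suc b) = refl
  ≡ᵇ-sym (suc a) zero = refl
  ≡ᵇ-sym (suc a) (suc b) = ≡ᵇ-sym a b
  symP : ∀ u v → ((toℕ u / 3 ≡ᵇ toℕ v / 3) ∧ not (toℕ u ≡ᵇ toℕ v))
               ≡ ((toℕ v / 3 ≡ᵇ toℕ u / 3) ∧ not (toℕ v ≡ᵇ toℕ u))
  symP u v = cong₂ _∧_ (≡ᵇ-sym (toℕ u / 3) (toℕ v / 3)) (cong not (≡ᵇ-sym (toℕ u) (toℕ v)))
  irr : ∀ u → ((toℕ u / 3 ≡ᵇ toℕ u / 3) ∧ not (toℕ u ≡ᵇ toℕ u)) ≡ false
  irr u rewrite ≡ᵇ-refl (toℕ u) = ∧-zeroʳ _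

-- A triangle with an edge leaving it contains both a paw (the pendant edge at a triangle vertex)
-- and a P₄ (pendant edge, then two triangle edges). So in a T₁- or P₄-free graph every triangle is
-- a connected component, each vertex lies in at most one triangle, and counting pairs
-- (vertex, triangle through it) gives 3·N(K₃,G) ≤ n. Conversely, in D(3,n) adjacency means
-- lying in the same block {3q, 3q+1, 3q+2} (or the short last block), so a connected
-- four-vertex subgraph would need four vertices in one block of at most three; the ⌊n/3⌋ full
-- blocks are triangles.

module Submission where

open import Data.Bool using (Bool; true; false; _∧_; _∨_; T; if_then_else_)
open import Data.Bool.Properties using (T-≡)
open import Data.Empty using (⊥; ⊥-elim)
open import Data.Fin as Fin using (Fin; zero; suc; toℕ; fromℕ<)
open import Data.Fin.Patterns using (0F; 1F; 2F; 3F)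
open import Data.Fin.Properties
  using (_≟_; any?; suc-injective; toℕ-injective; toℕ-fromℕ<; toℕ<n; <⇒≢; injective⇒≤)
import Data.List as List
open import Data.Nat
  using (ℕ; zero; suc; _+_; _*_; _/_; _%_; _≤_; _<_; _<?_; _<ᵇ_; _≡ᵇ_; NonZero; z≤n; s≤s; z<s; s<s)
open import Data.Nat.DivMod
  using (_mod_; m≡m%n+[m/n]*n; m*n/n≡m; m*n%n≡0; m<n⇒m%n≡m; m<n⇒m/n≡0; +-distrib-/;
         m/n*n≤m; m<n*o⇒m/o<n; /-monoˡ-≤)
import Data.Nat.ListAction as ListAction
open import Data.Nat.Properties
  using (+-*-semiring; ≤-refl; ≤-reflexive; ≤-trans; ≤-antisym; <⇒≤; <-trans; <-≤-trans; <-irrefl;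
         <-asym; <⇒≱; ≮⇒≥; n≮n; n≤0⇒n≡0; <ᵇ⇒<; <⇒<ᵇ; ≡ᵇ⇒≡; ≡⇒≡ᵇ; +-comm; +-identityʳ;
         +-cancelˡ-≡; +-mono-≤; +-monoʳ-<; m≤m+n; m≤n+m; *-monoˡ-≤; *-cancelʳ-≤;
         module ≤-Reasoning)
open import Algebra.Properties.Semiring.Sum +-*-semiring
  using (sum; sum-syntax; sum-cong-≗; sum-replicate-zero; ∑-comm; ∑-distrib-+;
         *-distribˡ-sum; *-distribʳ-sum)
open import Data.Product using (_×_; _,_; proj₁; proj₂)
open import Data.Sum using (_⊎_; inj₁; inj₂)
open import Data.Vec.Functional using (Vector; _∷_; [])
open import Function using (_∘_)
open import Function.Bundles using (Equivalence)
open import Function.Definitions using (Injective)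
open import Relation.Binary.PropositionalEquality
open import Relation.Nullary using (¬_; yes; no; does)

open import Defs hiding (sym; irrefl)

variable
  n : ℕ
  G : Graph n
  a b c i j k u v : Fin n

-- Finite sums

n≯0⇒n≡0 : ∀ {x} → ¬ 0 < x → x ≡ 0
n≯0⇒n≡0 = n≤0⇒n≡0 ∘ ≮⇒≥

sum-mono-≤ : {f g : Vector ℕ n} → (∀ i → f i ≤ g i) → sum f ≤ sum g
sum-mono-≤ {zero}  _   = z≤n
sum-mono-≤ {suc n} f≤g = +-mono-≤ (f≤g zero) (sum-mono-≤ (f≤g ∘ suc))

sum-zero : {f : Vector ℕ n} → (∀ i → f i ≡ 0) → sum f ≡ 0
sum-zero {n} f≡0 = trans (sum-cong-≗ f≡0) (sum-replicate-zero n)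

sum-concentrated : {f : Vector ℕ n} (a : Fin n) → (∀ i → i ≢ a → f i ≡ 0) → sum f ≡ f a
sum-concentrated {suc n} {f} zero    h =
  trans (cong (f zero +_) (sum-zero λ i → h (suc i) λ ())) (+-identityʳ (f zero))
sum-concentrated {suc n} {f} (suc a) h =
  trans (cong (_+ sum (f ∘ suc)) (h zero λ ()))
        (sum-concentrated a λ i i≢a → h (suc i) (i≢a ∘ suc-injective))

sum-term-≤ : {f : Vector ℕ n} (a : Fin n) → f a ≤ sum f
sum-term-≤ {suc n} {f} zero    = m≤m+n (f zero) _
sum-term-≤ {suc n} {f} (suc a) = ≤-trans (sum-term-≤ a) (m≤n+m _ (f zero))

sum-ones : ∑[ i < n ] 1 ≡ n
sum-ones {zero}  = refl
sum-ones {suc n} = cong suc sum-ones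

sum-indicator-< : ∀ {m} → m ≤ n → ∑[ v < n ] (if toℕ v <ᵇ m then 1 else 0) ≡ m
sum-indicator-< {n}     {zero}  _         = sum-zero {n} λ _ → refl
sum-indicator-< {suc n} {suc m} (s≤s m≤n) = cong suc (sum-indicator-< m≤n)

sum-map-tabulate : ∀ {A : Set} (f : A → ℕ) (g : Fin n → A) →
                   ListAction.sum (List.map f (List.tabulate g)) ≡ ∑[ i < n ] f (g i)
sum-map-tabulate {zero}  f g = refl
sum-map-tabulate {suc n} f g = cong (f (g zero) +_) (sum-map-tabulate f (g ∘ suc))

sum-allFin : {f g : Fin n → ℕ} → (∀ i → f i ≡ g i) →
             ListAction.sum (List.map f (List.allFin n)) ≡ sum g
sum-allFin {f = f} f≗g = trans (sum-map-tabulate f (λ i → i)) (sum-cong-≗ f≗g)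

sum³ : (Fin n → Fin n → Fin n → ℕ) → ℕ
sum³ {n} f = ∑[ i < n ] ∑[ j < n ] ∑[ k < n ] f i j k

sum³-cong : {f g : Fin n → Fin n → Fin n → ℕ} → (∀ i j k → f i j k ≡ g i j k) → sum³ f ≡ sum³ g
sum³-cong f≡g = sum-cong-≗ λ i → sum-cong-≗ λ j → sum-cong-≗ (f≡g i j)

sum³-zero : {f : Fin n → Fin n → Fin n → ℕ} → (∀ i j k → f i j k ≡ 0) → sum³ f ≡ 0
sum³-zero f≡0 = sum-zero λ i → sum-zero λ j → sum-zero (f≡0 i j)

sum³-point : {f : Fin n → Fin n → Fin n → ℕ} →
             (∀ i j k → 0 < f i j k → i ≡ a × j ≡ b × k ≡ c) → sum³ f ≡ f a b c
sum³-point {a = a} {b} {c} {f} supp = begin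
  sum³ f
    ≡⟨ sum-concentrated a (λ i i≢a → sum-zero λ j → sum-zero λ k →
         n≯0⇒n≡0 (i≢a ∘ proj₁ ∘ supp i j k)) ⟩
  ∑[ j < _ ] ∑[ k < _ ] f a j k
    ≡⟨ sum-concentrated b (λ j j≢b → sum-zero λ k → n≯0⇒n≡0 (j≢b ∘ proj₁ ∘ proj₂ ∘ supp a j k)) ⟩
  ∑[ k < _ ] f a b k
    ≡⟨ sum-concentrated c (λ k k≢c → n≯0⇒n≡0 (k≢c ∘ proj₂ ∘ proj₂ ∘ supp a b k)) ⟩
  f a b c ∎
  where open ≡-Reasoning

sum³-term-≤ : {f : Fin n → Fin n → Fin n → ℕ} (a b c : Fin n) → f a b c ≤ sum³ f
sum³-term-≤ {f = f} a b c =
  ≤-trans (sum-term-≤ c) (≤-trans (sum-term-≤ {f = λ j → sum (f a j)} b)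
                                  (sum-term-≤ {f = λ i → ∑[ j < _ ] sum (f i j)} a))

sum³-*ʳ : (f : Fin n → Fin n → Fin n → ℕ) (x : ℕ) → sum³ f * x ≡ sum³ (λ i j k → f i j k * x)
sum³-*ʳ f x =
  trans (*-distribʳ-sum x λ i → ∑[ j < _ ] sum (f i j)) (sum-cong-≗ λ i →
  trans (*-distribʳ-sum x λ j → sum (f i j)) (sum-cong-≗ λ j →
  *-distribʳ-sum x (f i j)))

sum³-sum : (g : Fin n → Fin n → Fin n → Fin n → ℕ) →
           sum³ (λ i j k → ∑[ v < n ] g v i j k) ≡ ∑[ v < n ] sum³ (g v)
sum³-sum g = trans (sum-cong-≗ λ i → trans (sum-cong-≗ λ j → ∑-comm λ k v → g v i j k)
                                           (∑-comm λ j v → sum λ k → g v i j k))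
                   (∑-comm λ i v → sum λ j → sum λ k → g v i j k)

-- Double counting triangles through their vertices

δ : Fin n → Fin n → ℕ
δ i j = if does (i ≟ j) then 1 else 0

δ-refl : (i : Fin n) → δ i i ≡ 1
δ-refl i with i ≟ i
... | yes _   = refl
... | no  i≢i = ⊥-elim (i≢i refl)

δ-≢ : i ≢ j → δ i j ≡ 0
δ-≢ {i = i} {j} i≢j with i ≟ j
... | yes i≡j = ⊥-elim (i≢j i≡j)
... | no  _   = refl

sum-δ : (a : Fin n) → ∑[ v < n ] δ v a ≡ 1
sum-δ a = trans (sum-concentrated a λ _ → δ-≢) (δ-refl a)

OneOf : Fin n → Fin n → Fin n → Fin n → Set
OneOf v a b c = v ≡ a ⊎ v ≡ b ⊎ v ≡ c

-- Counting v with multiplicity makes the sum over v equal 3 for every triple, distinct or not.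
multiplicity : Fin n → Fin n → Fin n → Fin n → ℕ
multiplicity v a b c = δ v a + δ v b + δ v c

sum-multiplicity : (a b c : Fin n) → ∑[ v < n ] multiplicity v a b c ≡ 3
sum-multiplicity a b c = begin
  ∑[ v < _ ] (δ v a + δ v b + δ v c)
    ≡⟨ ∑-distrib-+ (λ v → δ v a + δ v b) (λ v → δ v c) ⟩
  ∑[ v < _ ] (δ v a + δ v b) + ∑[ v < _ ] δ v c
    ≡⟨ cong (_+ ∑[ v < _ ] δ v c) (∑-distrib-+ (λ v → δ v a) (λ v → δ v b)) ⟩
  ∑[ v < _ ] δ v a + ∑[ v < _ ] δ v b + ∑[ v < _ ] δ v c
    ≡⟨ cong₂ _+_ (cong₂ _+_ (sum-δ a) (sum-δ b)) (sum-δ c) ⟩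
  3 ∎
  where open ≡-Reasoning

multiplicity-pos⇒OneOf : 0 < multiplicity v a b c → OneOf v a b c
multiplicity-pos⇒OneOf {v = v} {a} {b} {c} pos with v ≟ a | v ≟ b | v ≟ c
... | yes v≡a | _       | _       = inj₁ v≡a
... | no  _   | yes v≡b | _       = inj₂ (inj₁ v≡b)
... | no  _   | no  _   | yes v≡c = inj₂ (inj₂ v≡c)
... | no  _   | no  _   | no  _   with () ← pos

multiplicity-distinct : a ≢ b → a ≢ c → b ≢ c → OneOf v a b c → multiplicity v a b c ≡ 1
multiplicity-distinct {a = a} a≢b a≢c b≢c (inj₁ refl)
  rewrite δ-refl a | δ-≢ a≢b | δ-≢ a≢c = refl
multiplicity-distinct {b = b} a≢b a≢c b≢c (inj₂ (inj₁ refl))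
  rewrite δ-≢ (a≢b ∘ sym) | δ-refl b | δ-≢ b≢c = refl
multiplicity-distinct {c = c} a≢b a≢c b≢c (inj₂ (inj₂ refl))
  rewrite δ-≢ (a≢c ∘ sym) | δ-≢ (b≢c ∘ sym) | δ-refl c = refl

triangleIndicator : Graph n → Fin n → Fin n → Fin n → ℕ
triangleIndicator G i j k = if isTri G i j k then 1 else 0

triangles≡sum³ : (G : Graph n) → triangles G ≡ sum³ (triangleIndicator G)
triangles≡sum³ {n} G = sum-allFin {n} λ i → sum-allFin {n} λ j → sum-allFin {n} λ k → refl

incidence : Graph n → Fin n → Fin n → Fin n → Fin n → ℕ
incidence G v i j k = triangleIndicator G i j k * multiplicity v i j k

triangleDegree : Graph n → Fin n → ℕ
triangleDegree G v = sum³ (incidence G v)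

triangles-double-count : (G : Graph n) → triangles G * 3 ≡ ∑[ v < n ] triangleDegree G v
triangles-double-count {n} G = begin
  triangles G * 3
    ≡⟨ cong (_* 3) (triangles≡sum³ G) ⟩
  sum³ t * 3
    ≡⟨ sum³-*ʳ t 3 ⟩
  sum³ (λ i j k → t i j k * 3)
    ≡⟨ sum³-cong (λ i j k → trans (cong (t i j k *_) (sym (sum-multiplicity i j k)))
                                  (*-distribˡ-sum (t i j k) λ v → multiplicity v i j k)) ⟩
  sum³ (λ i j k → ∑[ v < n ] (t i j k * multiplicity v i j k))
    ≡⟨ sum³-sum (incidence G) ⟩
  ∑[ v < n ] triangleDegree G v ∎
  where
  open ≡-Reasoning
  t = triangleIndicator G

-- Graphs in which every triangle is a connected component

adj-sym : adj G u v ≡ true → adj G v u ≡ true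
adj-sym {G = G} {u} {v} uv = trans (Graph.sym G v u) uv

adj⇒≢ : adj G u v ≡ true → u ≢ v
adj⇒≢ {G = G} {u} uv refl with () ← trans (sym uv) (Graph.irrefl G u)

∧-≡-true : ∀ {x y} → x ∧ y ≡ true → x ≡ true × y ≡ true
∧-≡-true {true} y≡true = refl , y≡true

record Triangle (G : Graph n) (a b c : Fin n) : Set where
  field
    a<b : a Fin.< b
    b<c : b Fin.< c
    ab  : adj G a b ≡ true
    bc  : adj G b c ≡ true
    ac  : adj G a c ≡ true

isTri⇒Triangle : isTri G a b c ≡ true → Triangle G a b c
isTri⇒Triangle {a = a} {b} {c} tri
  with a<ᵇb , tri₁ ← ∧-≡-true tri
  with b<ᵇc , tri₂ ← ∧-≡-true tri₁
  with ab   , tri₃ ← ∧-≡-true tri₂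
  with bc   , ac   ← ∧-≡-true tri₃ = record
  { a<b = <ᵇ⇒< (toℕ a) (toℕ b) (Equivalence.from T-≡ a<ᵇb)
  ; b<c = <ᵇ⇒< (toℕ b) (toℕ c) (Equivalence.from T-≡ b<ᵇc)
  ; ab = ab ; bc = bc ; ac = ac }

Triangle⇒isTri : Triangle G a b c → isTri G a b c ≡ true
Triangle⇒isTri t
  rewrite Equivalence.to T-≡ (<⇒<ᵇ (Triangle.a<b t)) | Equivalence.to T-≡ (<⇒<ᵇ (Triangle.b<c t))
        | Triangle.ab t | Triangle.bc t | Triangle.ac t = refl

ClosedTriangles : Graph n → Set
ClosedTriangles G = ∀ a b c w → adj G a b ≡ true → adj G b c ≡ true → adj G a c ≡ true →
                    adj G a w ≡ true → w ≡ b ⊎ w ≡ c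

OneOf-neighbour : ClosedTriangles G → Triangle G a b c → OneOf v a b c →
                  adj G v u ≡ true → OneOf u a b c
OneOf-neighbour {G = G} closed t (inj₁ refl) vu
  with closed _ _ _ _ ab bc ac vu
  where open Triangle t
... | inj₁ u≡b = inj₂ (inj₁ u≡b)
... | inj₂ u≡c = inj₂ (inj₂ u≡c)
OneOf-neighbour {G = G} closed t (inj₂ (inj₁ refl)) vu
  with closed _ _ _ _ (adj-sym {G = G} ab) ac bc vu
  where open Triangle t
... | inj₁ u≡a = inj₁ u≡a
... | inj₂ u≡c = inj₂ (inj₂ u≡c)
OneOf-neighbour {G = G} closed t (inj₂ (inj₂ refl)) vu
  with closed _ _ _ _ (adj-sym {G = G} ac) ab (adj-sym {G = G} bc) vu
  where open Triangle t
... | inj₁ u≡a = inj₁ u≡a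
... | inj₂ u≡b = inj₂ (inj₁ u≡b)

Triangle-linked : Triangle G a b c → OneOf v a b c → OneOf u a b c → v ≡ u ⊎ adj G v u ≡ true
Triangle-linked {G = G} {a} {b} {c} t = linked
  where
  open Triangle t
  linked : ∀ {v u} → OneOf v a b c → OneOf u a b c → v ≡ u ⊎ adj G v u ≡ true
  linked (inj₁ refl)        (inj₁ refl)        = inj₁ refl
  linked (inj₁ refl)        (inj₂ (inj₁ refl)) = inj₂ ab
  linked (inj₁ refl)        (inj₂ (inj₂ refl)) = inj₂ ac
  linked (inj₂ (inj₁ refl)) (inj₁ refl)        = inj₂ (adj-sym {G = G} ab)
  linked (inj₂ (inj₁ refl)) (inj₂ (inj₁ refl)) = inj₁ refl
  linked (inj₂ (inj₁ refl)) (inj₂ (inj₂ refl)) = inj₂ bc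
  linked (inj₂ (inj₂ refl)) (inj₁ refl)        = inj₂ (adj-sym {G = G} ac)
  linked (inj₂ (inj₂ refl)) (inj₂ (inj₁ refl)) = inj₂ (adj-sym {G = G} bc)
  linked (inj₂ (inj₂ refl)) (inj₂ (inj₂ refl)) = inj₁ refl

OneOf-≥ : a Fin.< b → b Fin.< c → OneOf v a b c → a Fin.≤ v
OneOf-≥ a<b b<c (inj₁ refl)        = ≤-refl
OneOf-≥ a<b b<c (inj₂ (inj₁ refl)) = <⇒≤ a<b
OneOf-≥ a<b b<c (inj₂ (inj₂ refl)) = <⇒≤ (<-trans a<b b<c)

OneOf-≤ : a Fin.< b → b Fin.< c → OneOf v a b c → v Fin.≤ c
OneOf-≤ a<b b<c (inj₁ refl)        = <⇒≤ (<-trans a<b b<c)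
OneOf-≤ a<b b<c (inj₂ (inj₁ refl)) = <⇒≤ b<c
OneOf-≤ a<b b<c (inj₂ (inj₂ refl)) = ≤-refl

sorted-triple-unique : a Fin.< b → b Fin.< c → i Fin.< j → j Fin.< k →
                       OneOf i a b c → OneOf j a b c → OneOf k a b c → i ≡ a × j ≡ b × k ≡ c
sorted-triple-unique a<b b<c i<j j<k i∈ (inj₁ refl) k∈ =
  ⊥-elim (<⇒≱ i<j (OneOf-≥ a<b b<c i∈))
sorted-triple-unique a<b b<c i<j j<k i∈ (inj₂ (inj₂ refl)) k∈ =
  ⊥-elim (<⇒≱ j<k (OneOf-≤ a<b b<c k∈))
sorted-triple-unique {a = a} {b} {c} {i} {k = k} a<b b<c i<j j<k i∈ (inj₂ (inj₁ refl)) k∈ =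
  first i∈ , refl , last k∈
  where
  first : OneOf i a b c → i ≡ a
  first (inj₁ i≡a)         = i≡a
  first (inj₂ (inj₁ refl)) = ⊥-elim (<-irrefl refl i<j)
  first (inj₂ (inj₂ refl)) = ⊥-elim (<-asym i<j b<c)
  last : OneOf k a b c → k ≡ c
  last (inj₁ refl)         = ⊥-elim (<-asym a<b j<k)
  last (inj₂ (inj₁ refl))  = ⊥-elim (<-irrefl refl j<k)
  last (inj₂ (inj₂ k≡c))   = k≡c

triangle-unique : ClosedTriangles G → Triangle G a b c → Triangle G i j k →
                  OneOf v a b c → OneOf v i j k → i ≡ a × j ≡ b × k ≡ c
triangle-unique {G = G} {a} {b} {c} {i} {j} {k} closed t t′ v∈ v∈′ =
  sorted-triple-unique (Triangle.a<b t) (Triangle.b<c t) (Triangle.a<b t′) (Triangle.b<c t′)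
    (inside (inj₁ refl)) (inside (inj₂ (inj₁ refl))) (inside (inj₂ (inj₂ refl)))
  where
  inside : ∀ {u} → OneOf u i j k → OneOf u a b c
  inside u∈ with Triangle-linked t′ v∈′ u∈
  ... | inj₁ refl = v∈
  ... | inj₂ vu   = OneOf-neighbour closed t v∈ vu

incidence-pos : 0 < incidence G v i j k → Triangle G i j k × OneOf v i j k
incidence-pos {G = G} {v} {i} {j} {k} pos with isTri G i j k in tri
... | true  =
  isTri⇒Triangle tri , multiplicity-pos⇒OneOf {v = v} (subst (0 <_) (+-identityʳ _) pos)
... | false with () ← pos

incidence-triangle : Triangle G a b c → OneOf v a b c → incidence G v a b c ≡ 1
incidence-triangle {v = v} t v∈ rewrite Triangle⇒isTri t =
  trans (+-identityʳ _)
        (multiplicity-distinct {v = v} (<⇒≢ a<b) (<⇒≢ (<-trans a<b b<c)) (<⇒≢ b<c) v∈)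
  where open Triangle t

triangleDegree-≤1 : ClosedTriangles G → (v : Fin n) → triangleDegree G v ≤ 1
triangleDegree-≤1 {G = G} closed v
  with any? (λ a → any? (λ b → any? (λ c → 0 <? incidence G v a b c)))
... | no none =
  subst (_≤ 1) (sym (sum³-zero λ i j k → n≯0⇒n≡0 λ pos → none (i , j , k , pos))) z≤n
... | yes (a , b , c , pos) with t , v∈ ← incidence-pos {G = G} {v} pos =
  ≤-reflexive (trans (sum³-point unique) (incidence-triangle {v = v} t v∈))
  where
  unique : ∀ i j k → 0 < incidence G v i j k → i ≡ a × j ≡ b × k ≡ c
  unique i j k pos′ with t′ , v∈′ ← incidence-pos {G = G} {v} pos′ =
    triangle-unique closed t t′ v∈ v∈′

triangles-≤ : (G : Graph n) → ClosedTriangles G → triangles G ≤ n / 3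
triangles-≤ {n} G closed = begin
  triangles G                          ≡⟨ sym (m*n/n≡m (triangles G) 3) ⟩
  triangles G * 3 / 3                  ≡⟨ cong (_/ 3) (triangles-double-count G) ⟩
  (∑[ v < n ] triangleDegree G v) / 3  ≤⟨ /-monoˡ-≤ 3 (sum-mono-≤ degree≤1) ⟩
  (∑[ v < n ] 1) / 3                   ≡⟨ cong (_/ 3) (sum-ones {n}) ⟩
  n / 3                                ∎
  where
  open ≤-Reasoning
  degree≤1 : ∀ v → triangleDegree G v ≤ 1
  degree≤1 = triangleDegree-≤1 {G = G} closed

-- Forbidden subgraphs on four vertices

cons-injective : ∀ {A : Set} {x : A} {xs : Vector A n} →
                 (∀ i → x ≢ xs i) → Injective _≡_ _≡_ xs → Injective _≡_ _≡_ (x ∷ xs)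
cons-injective x∉xs xs-inj {zero}  {zero}  _   = refl
cons-injective x∉xs xs-inj {zero}  {suc j} x≡  = ⊥-elim (x∉xs j x≡)
cons-injective x∉xs xs-inj {suc i} {zero}  ≡x  = ⊥-elim (x∉xs i (sym ≡x))
cons-injective x∉xs xs-inj {suc i} {suc j} eq  = cong suc (xs-inj eq)

injective₄ : ∀ {A : Set} {x y z t : A} → x ≢ y → x ≢ z → x ≢ t → y ≢ z → y ≢ t → z ≢ t →
             Injective _≡_ _≡_ (x ∷ y ∷ z ∷ t ∷ [])
injective₄ x≢y x≢z x≢t y≢z y≢t z≢t =
  cons-injective {n = 3} (λ { 0F → x≢y ; 1F → x≢z ; 2F → x≢t })
    (cons-injective {n = 2} (λ { 0F → y≢z ; 1F → y≢t })
      (cons-injective {n = 1} (λ { 0F → z≢t })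
        (cons-injective {n = 0} (λ ()) λ { {()} })))

edges-symmetrised : ∀ {m} (G : Graph n) (f : Fin m → Fin n) (e : Fin m → Fin m → Bool) →
                    (∀ i j → e i j ≡ true → adj G (f i) (f j) ≡ true) →
                    ∀ i j → (e i j ∨ e j i) ≡ true → adj G (f i) (f j) ≡ true
edges-symmetrised G f e preserved i j _ with e i j in eij | e j i in eji
... | true  | _    = preserved i j eij
... | false | true = adj-sym {G = G} (preserved j i eji)

ClosedTriangles-intro : (∀ {a b c w} → adj G a b ≡ true → adj G b c ≡ true → adj G a c ≡ true →
                         adj G a w ≡ true → w ≢ b → w ≢ c → ⊥) →
                        ClosedTriangles G
ClosedTriangles-intro no-pendant a b c w ab bc ac aw with w ≟ b | w ≟ c
... | yes w≡b | _       = inj₁ w≡b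
... | no  _   | yes w≡c = inj₂ w≡c
... | no  w≢b | no  w≢c = ⊥-elim (no-pendant ab bc ac aw w≢b w≢c)

T1-free⇒ClosedTriangles : (G : Graph n) → Free T1 G → ClosedTriangles G
T1-free⇒ClosedTriangles G free = ClosedTriangles-intro {G = G}
  λ {a} {b} {c} {w} ab bc ac aw w≢b w≢c → free
    ( a ∷ b ∷ c ∷ w ∷ []
    , injective₄ (adj⇒≢ {G = G} ab) (adj⇒≢ {G = G} ac) (adj⇒≢ {G = G} aw) (adj⇒≢ {G = G} bc)
                 (w≢b ∘ sym) (w≢c ∘ sym)
    , edges-symmetrised G _ pawE λ { 0F 1F _ → ab ; 0F 2F _ → ac ; 1F 2F _ → bc ; 0F 3F _ → aw })

P4-free⇒ClosedTriangles : (G : Graph n) → Free P4 G → ClosedTriangles G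
P4-free⇒ClosedTriangles G free = ClosedTriangles-intro {G = G}
  λ {a} {b} {c} {w} ab bc ac aw w≢b w≢c → free
    ( w ∷ a ∷ b ∷ c ∷ []
    , injective₄ (adj⇒≢ {G = G} aw ∘ sym) w≢b w≢c
                 (adj⇒≢ {G = G} ab) (adj⇒≢ {G = G} ac) (adj⇒≢ {G = G} bc)
    , edges-symmetrised G _ p4E λ { 0F 1F _ → adj-sym {G = G} aw ; 1F 2F _ → ab ; 2F 3F _ → bc })

-- The extremal graph D(3,n)

block : Fin n → ℕ
block u = toℕ u / 3

D3-adj⇒same-block : (u v : Fin n) → adj (D3 n) u v ≡ true → block u ≡ block v
D3-adj⇒same-block u v uv =
  ≡ᵇ⇒≡ (block u) (block v) (Equivalence.from T-≡ (proj₁ (∧-≡-true uv)))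

same-block⇒D3-adj : block u ≡ block v → u ≢ v → adj (D3 n) u v ≡ true
same-block⇒D3-adj {u = u} {v} same u≢v
  with block u ≡ᵇ block v in same? | toℕ u ≡ᵇ toℕ v in u≡?v
... | true  | false = refl
... | false | _     = ⊥-elim (subst T same? (≡⇒≡ᵇ (block u) (block v) same))
... | true  | true  =
  ⊥-elim (u≢v (toℕ-injective (≡ᵇ⇒≡ (toℕ u) (toℕ v) (Equivalence.from T-≡ u≡?v))))

/-%-injective : ∀ {d x y} .{{_ : NonZero d}} → x / d ≡ y / d → x % d ≡ y % d → x ≡ y
/-%-injective {d} {x} {y} /≡ %≡ = begin
  x                  ≡⟨ m≡m%n+[m/n]*n x d ⟩
  x % d + x / d * d  ≡⟨ cong₂ (λ r q → r + q * d) %≡ /≡ ⟩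
  y % d + y / d * d  ≡⟨ sym (m≡m%n+[m/n]*n y d) ⟩
  y                  ∎
  where open ≡-Reasoning

no-four-in-a-block : (f : Fin 4 → Fin n) → Injective _≡_ _≡_ f →
                     (∀ i → block (f i) ≡ block (f 0F)) → ⊥
no-four-in-a-block f f-inj same = n≮n 3 (injective⇒≤ residue-injective)
  where
  residue : Fin 4 → Fin 3
  residue i = toℕ (f i) mod 3
  residue-injective : Injective _≡_ _≡_ residue
  residue-injective {i} {j} eq = f-inj (toℕ-injective (/-%-injective
    (trans (same i) (sym (same j)))
    (trans (sym (toℕ-fromℕ< _)) (trans (cong toℕ eq) (toℕ-fromℕ< _)))))

D3-T1-free : ∀ n → Free T1 (D3 n)
D3-T1-free n (f , f-inj , edges) = no-four-in-a-block f f-inj same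
  where
  linked : ∀ i j → adj T1 i j ≡ true → block (f i) ≡ block (f j)
  linked i j = D3-adj⇒same-block (f i) (f j) ∘ edges i j
  same : ∀ i → block (f i) ≡ block (f 0F)
  same 0F = refl
  same 1F = sym (linked 0F 1F refl)
  same 2F = sym (linked 0F 2F refl)
  same 3F = sym (linked 0F 3F refl)

D3-P4-free : ∀ n → Free P4 (D3 n)
D3-P4-free n (f , f-inj , edges) = no-four-in-a-block f f-inj same
  where
  linked : ∀ i j → adj P4 i j ≡ true → block (f i) ≡ block (f j)
  linked i j = D3-adj⇒same-block (f i) (f j) ∘ edges i j
  same : ∀ i → block (f i) ≡ block (f 0F)
  same 0F = refl
  same 1F = sym (linked 0F 1F refl)
  same 2F = sym (trans (linked 0F 1F refl) (linked 1F 2F refl))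
  same 3F = sym (trans (linked 0F 1F refl) (trans (linked 1F 2F refl) (linked 2F 3F refl)))

[m*n+o]/n≡m : ∀ m {n o} .{{_ : NonZero n}} → o < n → (m * n + o) / n ≡ m
[m*n+o]/n≡m m {n} {o} o<n = begin
  (m * n + o) / n    ≡⟨ +-distrib-/ (m * n) o residues<n ⟩
  m * n / n + o / n  ≡⟨ cong₂ _+_ (m*n/n≡m m n) (m<n⇒m/n≡0 o<n) ⟩
  m + 0              ≡⟨ +-identityʳ m ⟩
  m                  ∎
  where
  open ≡-Reasoning
  residues<n : m * n % n + o % n < n
  residues<n = subst (_< n) (sym (cong₂ _+_ (m*n%n≡0 m n) (m<n⇒m%n≡m o<n))) o<n

module FullBlock {n q : ℕ} (full : q * 3 + 3 ≤ n) where

  vertex : Fin 3 → Fin n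
  vertex r = fromℕ< (<-≤-trans (+-monoʳ-< (q * 3) (toℕ<n r)) full)

  toℕ-vertex : (r : Fin 3) → toℕ (vertex r) ≡ q * 3 + toℕ r
  toℕ-vertex r = toℕ-fromℕ< _

  block-vertex : (r : Fin 3) → block (vertex r) ≡ q
  block-vertex r = trans (cong (_/ 3) (toℕ-vertex r)) ([m*n+o]/n≡m q (toℕ<n r))

  vertex-injective : {r s : Fin 3} → vertex r ≡ vertex s → r ≡ s
  vertex-injective {r} {s} eq = toℕ-injective (+-cancelˡ-≡ (q * 3) (toℕ r) (toℕ s)
    (trans (sym (toℕ-vertex r)) (trans (cong toℕ eq) (toℕ-vertex s))))

  vertex-< : {r s : Fin 3} → r Fin.< s → vertex r Fin.< vertex s
  vertex-< {r} {s} r<s =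
    subst₂ _<_ (sym (toℕ-vertex r)) (sym (toℕ-vertex s)) (+-monoʳ-< (q * 3) r<s)

  vertex-adj : {r s : Fin 3} → r ≢ s → adj (D3 n) (vertex r) (vertex s) ≡ true
  vertex-adj {r} {s} r≢s =
    same-block⇒D3-adj (trans (block-vertex r) (sym (block-vertex s))) (r≢s ∘ vertex-injective)

  triangle : Triangle (D3 n) (vertex 0F) (vertex 1F) (vertex 2F)
  triangle = record
    { a<b = vertex-< z<s ; b<c = vertex-< (s<s z<s)
    ; ab = vertex-adj λ () ; bc = vertex-adj λ () ; ac = vertex-adj λ () }

  covers : {v : Fin n} → block v ≡ q → OneOf v (vertex 0F) (vertex 1F) (vertex 2F)
  covers {v} same = subst (λ x → OneOf x (vertex 0F) (vertex 1F) (vertex 2F)) (sym v≡vertex)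
                          (among (toℕ v mod 3))
    where
    among : (r : Fin 3) → OneOf (vertex r) (vertex 0F) (vertex 1F) (vertex 2F)
    among 0F = inj₁ refl
    among 1F = inj₂ (inj₁ refl)
    among 2F = inj₂ (inj₂ refl)
    v≡vertex : v ≡ vertex (toℕ v mod 3)
    v≡vertex = toℕ-injective (begin
      toℕ v                      ≡⟨ m≡m%n+[m/n]*n (toℕ v) 3 ⟩
      toℕ v % 3 + block v * 3    ≡⟨ +-comm (toℕ v % 3) (block v * 3) ⟩
      block v * 3 + toℕ v % 3    ≡⟨ cong₂ (λ x y → x * 3 + y) same (sym (toℕ-fromℕ< _)) ⟩
      q * 3 + toℕ (toℕ v mod 3)  ≡⟨ sym (toℕ-vertex _) ⟩
      toℕ (vertex (toℕ v mod 3)) ∎)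
      where open ≡-Reasoning

full-block : {v : Fin n} → toℕ v < n / 3 * 3 → block v * 3 + 3 ≤ n
full-block {n} {v} v<3⌊n/3⌋ = begin
  block v * 3 + 3    ≡⟨ +-comm (block v * 3) 3 ⟩
  suc (block v) * 3  ≤⟨ *-monoˡ-≤ 3 (m<n*o⇒m/o<n {toℕ v} {n / 3} v<3⌊n/3⌋) ⟩
  n / 3 * 3          ≤⟨ m/n*n≤m n 3 ⟩
  n                  ∎
  where open ≤-Reasoning

triangleDegree-D3 : {v : Fin n} → toℕ v < n / 3 * 3 → 1 ≤ triangleDegree (D3 n) v
triangleDegree-D3 {n} {v} v<3⌊n/3⌋ =
  subst (_≤ triangleDegree (D3 n) v) (incidence-triangle {v = v} triangle (covers refl))
        (sum³-term-≤ (vertex 0F) (vertex 1F) (vertex 2F))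
  where open FullBlock {q = block v} (full-block v<3⌊n/3⌋)

triangles-D3-≥ : ∀ n → n / 3 ≤ triangles (D3 n)
triangles-D3-≥ n = *-cancelʳ-≤ (n / 3) (triangles (D3 n)) 3 (begin
  n / 3 * 3                                          ≡⟨ sym (sum-indicator-< (m/n*n≤m n 3)) ⟩
  ∑[ v < n ] (if toℕ v <ᵇ n / 3 * 3 then 1 else 0)  ≤⟨ sum-mono-≤ indicator≤degree ⟩
  ∑[ v < n ] triangleDegree (D3 n) v                 ≡⟨ sym (triangles-double-count (D3 n)) ⟩
  triangles (D3 n) * 3                               ∎)
  where
  open ≤-Reasoning
  indicator≤degree : ∀ v → (if toℕ v <ᵇ n / 3 * 3 then 1 else 0) ≤ triangleDegree (D3 n) v
  indicator≤degree v with toℕ v <ᵇ n / 3 * 3 in v<?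
  ... | false = z≤n
  ... | true  = triangleDegree-D3 (<ᵇ⇒< (toℕ v) (n / 3 * 3) (Equivalence.from T-≡ v<?))

triangles-D3 : ∀ n → triangles (D3 n) ≡ n / 3
triangles-D3 n =
  ≤-antisym (triangles-≤ (D3 n) (T1-free⇒ClosedTriangles (D3 n) (D3-T1-free n))) (triangles-D3-≥ n)

ExK3-by-ClosedTriangles : ∀ {k} n (F : Graph k) → Free F (D3 n) →
                          (∀ G → Free F G → ClosedTriangles G) → ExK3 n F (n / 3)
ExK3-by-ClosedTriangles n F D3-free closed =
  (D3 n , D3-free , triangles-D3 n) , λ G free → triangles-≤ G (closed G free)

mainTheorem16 : ∀ (n : ℕ) →
    ExK3 n T1 (n / 3) × ExK3 n P4 (n / 3) × triangles (D3 n) ≡ n / 3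
mainTheorem16 n =
  ExK3-by-ClosedTriangles n T1 (D3-T1-free n) T1-free⇒ClosedTriangles ,
  ExK3-by-ClosedTriangles n P4 (D3-P4-free n) P4-free⇒ClosedTriangles ,
  triangles-D3 n
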